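{- Let $S$ be a set and let $f\colon 2^S\to 2^S$ be monotonic with respect to $\subseteq$ on the subset lattice $(2^S,\subseteq,\bigcup,\bigcap)$. (1) For every $X\subseteq S$, if $X$ is well-supported for $f$, then $X\subseteq \mu f$. (2) Let $\mathcal{X}=\{X\subseteq S \mid X \text{ is well-supported for } f\}$. Then $f(\bigcup\mathcal{X})=\bigcup\mathcal{X}$.
   Context: $\mu f$ denotes the least fixpoint of $f$. A support ordering for $f$ is a pair $(X,\prec)$ with $X\subseteq S$ and $\prec\subseteq X\times X$ a binary relation such that for every $x\in X$, $x\in f(\{x'\in X\mid x'\prec x\})$. A relation is well-founded if every nonempty subset of its carrier has a minimal element. A set $X\subseteq S$ is well-supported for $f$ if there is a well-founded $\prec\subseteq X\times X$ such that $(X,\prec)$ is a support ordering for $f$. The Axiom of Choice is assumed. -}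

module Defs where

open import Data.Bool using (Bool; true; false; _∧_)
open import Data.Product using (Σ; ∃; _×_; _,_)
open import Relation.Binary.PropositionalEquality using (_≡_)
open import Relation.Nullary using (¬_)
open import Function.Bundles using (_⇔_)

Subset : Set → Set
Subset S = S → Bool

_∈ₛ_ : {S : Set} → S → Subset S → Set
x ∈ₛ A = A x ≡ true

_⊆ₛ_ : {S : Set} → Subset S → Subset S → Set
A ⊆ₛ B = ∀ x → x ∈ₛ A → x ∈ₛ B

_≐_ : {S : Set} → Subset S → Subset S → Set
A ≐ B = (A ⊆ₛ B) × (B ⊆ₛ A)

Monotone : {S : Set} → (Subset S → Subset S) → Set
Monotone {S} f = (A B : Subset S) → A ⊆ₛ B → f A ⊆ₛ f B

IsLeastFixpoint : {S : Set} → (Subset S → Subset S) → Subset S → Set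
IsLeastFixpoint {S} f μ = (f μ ≐ μ) × ((Y : Subset S) → f Y ≐ Y → μ ⊆ₛ Y)

Rel : Set → Set
Rel S = S → S → Bool

RelOn : {S : Set} → Subset S → Rel S → Set
RelOn X R = ∀ x y → R x y ≡ true → (x ∈ₛ X) × (y ∈ₛ X)

WellFoundedOn : {S : Set} → Subset S → Rel S → Set
WellFoundedOn {S} X R =
  (A : Subset S) → A ⊆ₛ X → (∃ λ x → x ∈ₛ A) →
  ∃ λ m → (m ∈ₛ A) × (∀ y → y ∈ₛ A → ¬ (R y m ≡ true))

SupportOrdering : {S : Set} → (Subset S → Subset S) → Subset S → Rel S → Set
SupportOrdering f X R =
  RelOn X R × (∀ x → x ∈ₛ X → x ∈ₛ f (λ x' → X x' ∧ R x' x))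

WellSupported : {S : Set} → (Subset S → Subset S) → Subset S → Set
WellSupported f X = ∃ λ R → WellFoundedOn X R × SupportOrdering f X R

IsUnionOf : {S : Set} → (Subset S → Set) → Subset S → Set
IsUnionOf {S} P U = ∀ x → (x ∈ₛ U) ⇔ (∃ λ (X : Subset S) → P X × (x ∈ₛ X))

{-# OPTIONS --safe #-}
-- Part (1) is well-founded induction along the support ordering into the
-- prefixpoint μf.  For part (2), U ⊆ f U is immediate, and f U ⊆ U follows once
-- some well-supported set contains f U.  That set is the set of derivable
-- elements: x is derivable if x ∈ f A for a set A of derivable elements.  It is
-- f-closed and contains every well-supported set (by part (1)'s argument).  To
-- well-support it, measure derivations by Brouwer trees; classically these are
-- totally ordered, so each derivable element has a derivation of minimum height,
-- and ordering elements by these heights is a well-founded support ordering.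
module Submission where

open import Defs
open import Level using (0ℓ)
open import Data.Bool using (Bool; true; false; _∧_; not)
open import Data.Bool.Properties using (∧-conicalˡ; ∧-conicalʳ)
open import Data.Empty using (⊥-elim)
open import Data.Product using (Σ; _×_; _,_)
open import Data.Sum using (_⊎_; inj₁; inj₂)
open import Function.Bundles using (Equivalence)
open import Induction.WellFounded using (Acc; acc; WellFounded)
open import Relation.Nullary using (¬_; Dec; does; yes; no)
open import Relation.Nullary.Decidable using (dec-true; decidable-stable)
open import Relation.Binary.PropositionalEquality using (_≡_; refl)
open import Axiom.ExcludedMiddle using (ExcludedMiddle)

∧-intro : ∀ {a b} → a ≡ true → b ≡ true → a ∧ b ≡ true
∧-intro refl refl = refl

true⊎not-true : (b : Bool) → b ≡ true ⊎ not b ≡ true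
true⊎not-true true = inj₁ refl
true⊎not-true false = inj₂ refl

not-true⇒¬true : ∀ {b} → not b ≡ true → ¬ b ≡ true
not-true⇒¬true {true} ()

dec-true⁻¹ : {P : Set} (p? : Dec P) → does p? ≡ true → P
dec-true⁻¹ (yes p) _ = p
dec-true⁻¹ (no _) ()

module _ {S : Set} where

  wellFoundedOn-induction : {X : Subset S} {R : Rel S} → WellFoundedOn X R →
    (Y : Subset S) → (∀ x → x ∈ₛ X → (λ y → X y ∧ R y x) ⊆ₛ Y → x ∈ₛ Y) →
    X ⊆ₛ Y
  wellFoundedOn-induction {X} {R} wf Y step x x∈X with true⊎not-true (Y x)
  ... | inj₁ x∈Y = x∈Y
  ... | inj₂ x∉Y
    with wf (λ z → X z ∧ not (Y z)) (λ z → ∧-conicalˡ (X z) _) (x , ∧-intro x∈X x∉Y)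
  ...   | m , m∈X∖Y , minimal =
    ⊥-elim (not-true⇒¬true (∧-conicalʳ (X m) _ m∈X∖Y)
                           (step m (∧-conicalˡ (X m) _ m∈X∖Y) below-m⊆Y))
    where
    below-m⊆Y : (λ y → X y ∧ R y m) ⊆ₛ Y
    below-m⊆Y y y≺m with true⊎not-true (Y y)
    ... | inj₁ y∈Y = y∈Y
    ... | inj₂ y∉Y =
      ⊥-elim (minimal y (∧-intro (∧-conicalˡ (X y) _ y≺m) y∉Y) (∧-conicalʳ (X y) _ y≺m))

module _ {S : Set} {f : Subset S → Subset S} (mono : Monotone f) where

  wellSupported⇒⊆f : {X : Subset S} → WellSupported f X → X ⊆ₛ f X
  wellSupported⇒⊆f {X} (R , _ , _ , supported) x x∈X =
    mono (λ y → X y ∧ R y x) X (λ y → ∧-conicalˡ (X y) _) x (supported x x∈X)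

  wellSupported⊆prefixpoint : {X Y : Subset S} → WellSupported f X → f Y ⊆ₛ Y → X ⊆ₛ Y
  wellSupported⊆prefixpoint {X} {Y} (R , wf , _ , supported) fY⊆Y =
    wellFoundedOn-induction wf Y λ x x∈X below-x⊆Y →
      fY⊆Y x (mono (λ y → X y ∧ R y x) Y below-x⊆Y x (supported x x∈X))

data Tree : Set₁ where
  sup : (I : Set) → (I → Tree) → Tree

_≤ᵗ_ : Tree → Tree → Set
_<ᵗ_ : Tree → Tree → Set
sup I g ≤ᵗ t = (i : I) → g i <ᵗ t
t <ᵗ sup J h = Σ J λ j → t ≤ᵗ h j

≤ᵗ-refl : ∀ t → t ≤ᵗ t
≤ᵗ-refl (sup I g) i = i , ≤ᵗ-refl (g i)

<ᵗ-sup : ∀ {I} {g : I → Tree} (i : I) → g i <ᵗ sup I g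
<ᵗ-sup {g = g} i = i , ≤ᵗ-refl (g i)

≤ᵗ-trans : ∀ {r s t} → r ≤ᵗ s → s ≤ᵗ t → r ≤ᵗ t
<-≤ᵗ-trans : ∀ {r s t} → r <ᵗ s → s ≤ᵗ t → r <ᵗ t
≤ᵗ-trans {sup I g} r≤s s≤t i = <-≤ᵗ-trans (r≤s i) s≤t
<-≤ᵗ-trans {s = sup J h} {sup K l} (j , r≤hj) s≤t with s≤t j
... | k , hj≤lk = k , ≤ᵗ-trans r≤hj hj≤lk

<ᵗ-wellFounded : WellFounded _<ᵗ_
<ᵗ-wellFounded t = acc (below t)
  where
  below : ∀ s {t} → t <ᵗ s → Acc _<ᵗ_ t
  below (sup J h) (j , t≤hj) = acc λ r<t → below (h j) (<-≤ᵗ-trans r<t t≤hj)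

module Classical (lem : ExcludedMiddle 0ℓ) where

  ≤ᵗ-total : ∀ s t → s ≤ᵗ t ⊎ t <ᵗ s
  ≤ᵗ-total (sup I g) (sup J h) with lem {Σ I λ i → ¬ g i <ᵗ sup J h}
  ... | no ∄i = inj₁ λ i → decidable-stable lem λ gi≮t → ∄i (i , gi≮t)
  ... | yes (i , gi≮t) = inj₂ (i , λ j → hj<gi j (≤ᵗ-total (g i) (h j)))
    where
    hj<gi : ∀ j → g i ≤ᵗ h j ⊎ h j <ᵗ g i → h j <ᵗ g i
    hj<gi j (inj₁ gi≤hj) = ⊥-elim (gi≮t (j , gi≤hj))
    hj<gi j (inj₂ hj<gi) = hj<gi

  ≤ᵗ-minimum : {A : Set} (height : A → Tree) → A → Σ A λ a₀ → ∀ a → height a₀ ≤ᵗ height a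
  ≤ᵗ-minimum {A} height a = descend a (<ᵗ-wellFounded (height a))
    where
    descend : ∀ a → Acc _<ᵗ_ (height a) → Σ A λ a₀ → ∀ a → height a₀ ≤ᵗ height a
    descend a (acc rs) with lem {Σ A λ b → height b <ᵗ height a}
    ... | yes (b , b<a) = descend b (rs b<a)
    ... | no ∄b = a , λ b → a≤b b (≤ᵗ-total (height a) (height b))
      where
      a≤b : ∀ b → height a ≤ᵗ height b ⊎ height b <ᵗ height a → height a ≤ᵗ height b
      a≤b b (inj₁ a≤b) = a≤b
      a≤b b (inj₂ b<a) = ⊥-elim (∄b (b , b<a))

  module _ {S : Set} where

    ⟦_⟧ : (S → Set) → Subset S
    ⟦ P ⟧ x = does (lem {P x})

    ∈⟦⟧⁺ : (P : S → Set) {x : S} → P x → x ∈ₛ ⟦ P ⟧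
    ∈⟦⟧⁺ P = dec-true lem

    ∈⟦⟧⁻ : (P : S → Set) {x : S} → x ∈ₛ ⟦ P ⟧ → P x
    ∈⟦⟧⁻ P = dec-true⁻¹ lem

    wellFoundedOn-byHeights : {X : Subset S} {R : Rel S}
      (W : S → Set) (height : ∀ {x} → W x → Tree) → (∀ x → x ∈ₛ X → W x) →
      (∀ y x → R y x ≡ true → Σ (W y) λ wy → (wx : W x) → height wy <ᵗ height wx) →
      WellFoundedOn X R
    wellFoundedOn-byHeights {X} {R} W height witness descends A A⊆X (a , a∈A) =
      descend a a∈A (witness a (A⊆X a a∈A)) (<ᵗ-wellFounded _)
      where
      descend : ∀ a → a ∈ₛ A → (wa : W a) → Acc _<ᵗ_ (height wa) →
                Σ S λ m → m ∈ₛ A × (∀ y → y ∈ₛ A → ¬ R y m ≡ true)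
      descend a a∈A wa (acc rs) with lem {Σ S λ y → y ∈ₛ A × R y a ≡ true}
      ... | no ∄y = a , a∈A , λ y y∈A Rya → ∄y (y , y∈A , Rya)
      ... | yes (y , y∈A , Rya) with descends y a Rya
      ...   | wy , wy<ᵗ = descend y y∈A wy (rs (wy<ᵗ wa))

  module Derivations {S : Set} (f : Subset S → Subset S) where

    data Derivation (x : S) : Set where
      by : (A : Subset S) → (∀ y → y ∈ₛ A → Derivation y) → x ∈ₛ f A → Derivation x

    height : ∀ {x} → Derivation x → Tree
    height (by A premises _) = sup (Σ S λ y → y ∈ₛ A) λ (y , y∈A) → height (premises y y∈A)

    derivable : Subset S
    derivable = ⟦ Derivation ⟧

    derivable-prefixpoint : f derivable ⊆ₛ derivable
    derivable-prefixpoint x x∈f = ∈⟦⟧⁺ Derivation (by derivable (λ y → ∈⟦⟧⁻ Derivation) x∈f)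

    -- The derivation of x is kept so that ≺ relates derivable elements only.
    _≺_ : S → S → Set
    y ≺ x = Σ (Derivation y) λ dy →
            Derivation x × ((dx : Derivation x) → height dy <ᵗ height dx)

    derivable-wellSupported : Monotone f → WellSupported f derivable
    derivable-wellSupported mono = (λ y x → ⟦ _≺ x ⟧ y) , wellFounded , onDerivable , supported
      where
      wellFounded : WellFoundedOn derivable (λ y x → ⟦ _≺ x ⟧ y)
      wellFounded = wellFoundedOn-byHeights Derivation height (λ x → ∈⟦⟧⁻ Derivation)
        λ y x y≺x → let (dy , _ , dy<ᵗ) = ∈⟦⟧⁻ (_≺ x) y≺x in dy , dy<ᵗ

      onDerivable : RelOn derivable (λ y x → ⟦ _≺ x ⟧ y)
      onDerivable y x y≺x =
        let (dy , dx , _) = ∈⟦⟧⁻ (_≺ x) y≺x in ∈⟦⟧⁺ Derivation dy , ∈⟦⟧⁺ Derivation dx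

      supported : ∀ x → x ∈ₛ derivable → x ∈ₛ f (λ y → derivable y ∧ ⟦ _≺ x ⟧ y)
      supported x x∈D with ≤ᵗ-minimum height (∈⟦⟧⁻ Derivation x∈D)
      ... | by A premises x∈fA , minimum = mono A _ A⊆below x x∈fA
        where
        A⊆below : A ⊆ₛ (λ y → derivable y ∧ ⟦ _≺ x ⟧ y)
        A⊆below y y∈A = ∧-intro (∈⟦⟧⁺ Derivation (premises y y∈A)) (∈⟦⟧⁺ (_≺ x) y≺x)
          where
          y≺x : y ≺ x
          y≺x = premises y y∈A , by A premises x∈fA ,
                λ dx → <-≤ᵗ-trans (<ᵗ-sup (y , y∈A)) (minimum dx)

wellSupported⊆leastFixpoint : {S : Set} {f : Subset S → Subset S} → Monotone f →
  (X : Subset S) → WellSupported f X → (μf : Subset S) → IsLeastFixpoint f μf → X ⊆ₛ μf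
wellSupported⊆leastFixpoint mono X ws μf ((fμf⊆μf , _) , _) =
  wellSupported⊆prefixpoint mono ws fμf⊆μf

unionOfWellSupported-isFixpoint : ExcludedMiddle 0ℓ →
  {S : Set} {f : Subset S → Subset S} → Monotone f →
  (U : Subset S) → IsUnionOf (WellSupported f) U → f U ≐ U
unionOfWellSupported-isFixpoint lem {f = f} mono U U-union = fU⊆U , U⊆fU
  where
  open Classical lem
  open Derivations f

  wellSupported⊆U : ∀ {X} → WellSupported f X → X ⊆ₛ U
  wellSupported⊆U ws x x∈X = Equivalence.from (U-union x) (_ , ws , x∈X)

  U⊆derivable : U ⊆ₛ derivable
  U⊆derivable x x∈U with Equivalence.to (U-union x) x∈U
  ... | X , ws , x∈X = wellSupported⊆prefixpoint mono ws derivable-prefixpoint x x∈X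

  fU⊆U : f U ⊆ₛ U
  fU⊆U x x∈fU = wellSupported⊆U (derivable-wellSupported mono) x
    (derivable-prefixpoint x (mono U derivable U⊆derivable x x∈fU))

  U⊆fU : U ⊆ₛ f U
  U⊆fU x x∈U with Equivalence.to (U-union x) x∈U
  ... | X , ws , x∈X = mono X U (wellSupported⊆U ws) x (wellSupported⇒⊆f mono ws x x∈X)

theorem1 : ExcludedMiddle 0ℓ →
    (S : Set) (f : Subset S → Subset S) → Monotone f →
    ((X : Subset S) → WellSupported f X →
       (μf : Subset S) → IsLeastFixpoint f μf → X ⊆ₛ μf)
    × ((U : Subset S) → IsUnionOf (WellSupported f) U → f U ≐ U)
theorem1 lem S f mono =
  wellSupported⊆leastFixpoint mono , unionOfWellSupported-isFixpoint lem mono
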